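{- Let $m,M\ge 2$ be integers and let $S= s_1 \cdots s_n$ be a minimal zero-sum sequence over $\llbracket -m,M \rrbracket$ such that at least two elements of $S$ (counted with multiplicity) are different from both $-m$ and $M$. Then there is a permutation $\sigma$ of $\{ 1, \dots , n \}$ such that one of the following holds: (i) for every integer $k$ with $1\leq k \leq n$, $\sum_{i=1}^k s_{\sigma (i)} \in \llbracket -(m-1),M-2 \rrbracket$; (ii) for every integer $k$ with $1\leq k \leq n$, $\sum_{i=1}^k s_{\sigma (i)} \in \llbracket -(m-2),M-1 \rrbracket$; (iii) the elements of $S$ which are different from both $-m$ and $M$ are either all equal to $M-1$ or all equal to $-(m-1)$. In particular, in cases (i) and (ii), $|S| \leq m+M-2$.
   Context: A finite sequence of integers $S=s_1\cdots s_n$ is an unordered finite multiset of integers; $|S|=n$ is its length. $S$ is a zero-sum sequence if $\sum_{i=1}^n s_i=0$, and a minimal zero-sum sequence if moreover $\sum_{i\in I}s_i\neq 0$ for every non-empty proper subset $I\subsetneq\{1,\dots,n\}$. A sequence is over a set $A$ if all its elements lie in $A$. For integers $a\le b$, $\llbracket a,b\rrbracket$ denotes the set of integers $i$ with $a\le i\le b$. -}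

module Defs where

open import Data.Nat using (ℕ; zero; suc; _<ᵇ_)
open import Data.Bool using (Bool; true; false; if_then_else_)
open import Data.Fin using (Fin; toℕ)
import Data.Fin as F
open import Data.Fin.Subset using (Subset; _∈_; Nonempty; ⊤)
open import Data.Vec using (lookup)
open import Data.Integer using (ℤ; 0ℤ; _+_; _≤_; -_)
open import Data.Product using (_×_; ∃)
open import Relation.Binary.PropositionalEquality using (_≡_; _≢_)

Seq : ℕ → Set
Seq n = Fin n → ℤ

sumF : ∀ {n} → (Fin n → ℤ) → ℤ
sumF {zero}  f = 0ℤ
sumF {suc n} f = f F.zero + sumF (λ i → f (F.suc i))

sumOver : ∀ {n} → Seq n → Subset n → ℤ
sumOver s I = sumF (λ i → if lookup I i then s i else 0ℤ)

prefixSum : ∀ {n} → Seq n → ℕ → ℤ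
prefixSum t k = sumF (λ i → if toℕ i <ᵇ k then t i else 0ℤ)

IsZeroSum : ∀ {n} → Seq n → Set
IsZeroSum s = sumF s ≡ 0ℤ

IsMinimalZeroSum : ∀ {n} → Seq n → Set
IsMinimalZeroSum {n} s =
  IsZeroSum s × (∀ (I : Subset n) → Nonempty I → I ≢ ⊤ → sumOver s I ≢ 0ℤ)

_∈⟦_,_⟧ : ℤ → ℤ → ℤ → Set
x ∈⟦ a , b ⟧ = (a ≤ x) × (x ≤ b)

SeqOver : ∀ {n} → Seq n → ℤ → ℤ → Set
SeqOver s a b = ∀ i → s i ∈⟦ a , b ⟧

-- Order S greedily: after a start term, add a negative term while the partial sum is positive and a
-- positive one while it is negative. With terms in ⟦-m, M⟧ the partial sums then stay in
-- ⟦-(m-1), M-2⟧, except that a step taken from -1 must be at most M-1. Minimality makes the partial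
-- sums pairwise distinct, so -1 is visited at most once, and it suffices to hold back one term in
-- ⟦1, M-1⟧ until then. Two terms other than -m and M supply a start and such a reserve for S (case (i))
-- or for -S, which exchanges m and M (case (ii)), unless they are all M-1 or all -(m-1). Distinct
-- partial sums in an interval of m+M-2 integers give the bound on |S|.

module Submission where

open import Defs
open import Data.Nat using (ℕ; _≤_; _<_; _∸_)
open import Data.Fin using (Fin; toℕ)
open import Data.Fin.Permutation using (Permutation′; _⟨$⟩ʳ_)
open import Data.Integer using (ℤ; +_; -_; _+_; _-_; 1ℤ)
import Data.Integer as Z
open import Data.Product using (_×_; ∃; ∃-syntax; Σ-syntax)
open import Data.Sum using (_⊎_)
open import Relation.Binary.PropositionalEquality using (_≡_; _≢_)

import Algebra.Properties.AbelianGroup as AbelianGroupProperties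
import Algebra.Properties.CommutativeMonoid.Sum as CommutativeMonoidSum
open import Data.Bool using (Bool; true; false; if_then_else_; not; _∧_)
open import Data.Bool.Properties using (T-≡)
open import Data.Fin using (zero; suc; punchIn; punchOut; fromℕ<)
import Data.Fin.Permutation as Perm
open import Data.Fin.Permutation using (_⟨$⟩ˡ_; inverseˡ)
import Data.Fin.Properties as Fin
open import Data.Fin.Subset using (⊤)
open import Data.Integer using (0ℤ; -1ℤ; +[1+_]; -[1+_])
import Data.Integer.Properties as ℤ
open import Data.Integer.Tactic.RingSolver using (solve)
open import Data.List using ([]; _∷_)
import Data.Nat as ℕ
open import Data.Nat using (_<ᵇ_)
import Data.Nat.Properties as ℕ
open import Data.Product using (_,_; proj₁; proj₂; map₂; curry)
open import Data.Sum using (inj₁; inj₂)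
open import Data.Vec using (tabulate; lookup)
open import Data.Vec.Functional using (removeAt; insertAt)
open import Data.Vec.Functional.Properties using (insertAt-lookup; insertAt-punchIn; removeAt-punchOut)
open import Data.Vec.Properties using (lookup∘tabulate; lookup⇒[]=; lookup-replicate)
open import Function using (_∘_; case_of_)
open import Function.Bundles using (Equivalence)
open import Function.Definitions using (Injective)
open import Relation.Binary.Definitions using (tri<; tri≈; tri>)
open import Relation.Binary.PropositionalEquality using (refl; sym; trans; cong; cong₂; subst; module ≡-Reasoning)
open import Relation.Nullary using (¬_; yes; no; ¬?; _×-dec_)
open import Relation.Nullary.Decidable using (decidable-stable)
open import Relation.Nullary.Negation using (contradiction)
open import Relation.Unary using (Pred; Decidable)

private
  module Σℤ = CommutativeMonoidSum ℤ.+-0-commutativeMonoid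
  module +ℤ = AbelianGroupProperties ℤ.+-0-abelianGroup

sumF≡sum : ∀ {n} (f : Fin n → ℤ) → sumF f ≡ Σℤ.sum f
sumF≡sum {ℕ.zero} f = refl
sumF≡sum {ℕ.suc n} f = cong (_+_ (f zero)) (sumF≡sum (f ∘ suc))

sumF-cong : ∀ {n} {f g : Fin n → ℤ} → (∀ i → f i ≡ g i) → sumF f ≡ sumF g
sumF-cong {ℕ.zero} f≗g = refl
sumF-cong {ℕ.suc n} f≗g = cong₂ _+_ (f≗g zero) (sumF-cong (f≗g ∘ suc))

sumF-zero : ∀ {n} → sumF {n} (λ _ → 0ℤ) ≡ 0ℤ
sumF-zero {ℕ.zero} = refl
sumF-zero {ℕ.suc n} = cong (_+_ 0ℤ) (sumF-zero {n})

sumF-neg : ∀ {n} (f : Fin n → ℤ) → sumF (λ i → - f i) ≡ - sumF f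
sumF-neg {ℕ.zero} f = refl
sumF-neg {ℕ.suc n} f =
  trans (cong (_+_ (- f zero)) (sumF-neg (f ∘ suc))) (sym (ℤ.neg-distrib-+ (f zero) _))

sumF-mono-≤ : ∀ {n} {f g : Fin n → ℤ} → (∀ i → f i Z.≤ g i) → sumF f Z.≤ sumF g
sumF-mono-≤ {ℕ.zero} f≤g = ℤ.≤-refl
sumF-mono-≤ {ℕ.suc n} f≤g = ℤ.+-mono-≤ (f≤g zero) (sumF-mono-≤ (f≤g ∘ suc))

sumF-+ : ∀ {n} (f g : Fin n → ℤ) → sumF (λ i → f i + g i) ≡ sumF f + sumF g
sumF-+ f g = begin
  sumF (λ i → f i + g i)   ≡⟨ sumF≡sum (λ i → f i + g i) ⟩
  Σℤ.sum (λ i → f i + g i) ≡⟨ Σℤ.∑-distrib-+ f g ⟩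
  Σℤ.sum f + Σℤ.sum g      ≡⟨ sym (cong₂ _+_ (sumF≡sum f) (sumF≡sum g)) ⟩
  sumF f + sumF g          ∎
  where open ≡-Reasoning

sumF-removeAt : ∀ {n} (f : Fin (ℕ.suc n) → ℤ) i → sumF f ≡ f i + sumF (removeAt f i)
sumF-removeAt f i = begin
  sumF f                          ≡⟨ sumF≡sum f ⟩
  Σℤ.sum f                        ≡⟨ Σℤ.sum-remove f ⟩
  f i + Σℤ.sum (removeAt f i)     ≡⟨ cong (_+_ (f i)) (sym (sumF≡sum (removeAt f i))) ⟩
  f i + sumF (removeAt f i)       ∎
  where open ≡-Reasoning

sumF-permute : ∀ {n} (f : Fin n → ℤ) (σ : Permutation′ n) → sumF f ≡ sumF (λ i → f (σ ⟨$⟩ʳ i))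
sumF-permute f σ = begin
  sumF f                         ≡⟨ sumF≡sum f ⟩
  Σℤ.sum f                       ≡⟨ Σℤ.sum-permute f σ ⟩
  Σℤ.sum (λ i → f (σ ⟨$⟩ʳ i))    ≡⟨ sym (sumF≡sum (λ i → f (σ ⟨$⟩ʳ i))) ⟩
  sumF (λ i → f (σ ⟨$⟩ʳ i))      ∎
  where open ≡-Reasoning

sumF<0⇒∃<0 : ∀ {n} (f : Fin n → ℤ) → sumF f Z.< 0ℤ → ∃ λ i → f i Z.< 0ℤ
sumF<0⇒∃<0 {n} f ∑f<0 with Fin.any? (λ i → f i ℤ.<? 0ℤ)
... | yes found = found
... | no none = contradiction 0≤∑f (ℤ.<⇒≱ ∑f<0)
  where
  0≤∑f : 0ℤ Z.≤ sumF f
  0≤∑f = ℤ.≤-trans (ℤ.≤-reflexive (sym (sumF-zero {n})))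
                   (sumF-mono-≤ (λ i → ℤ.≮⇒≥ (λ fᵢ<0 → none (i , fᵢ<0))))

0<sumF⇒∃>0 : ∀ {n} (f : Fin n → ℤ) → 0ℤ Z.< sumF f → ∃ λ i → 0ℤ Z.< f i
0<sumF⇒∃>0 {n} f 0<∑f with Fin.any? (λ i → 0ℤ ℤ.<? f i)
... | yes found = found
... | no none = contradiction ∑f≤0 (ℤ.<⇒≱ 0<∑f)
  where
  ∑f≤0 : sumF f Z.≤ 0ℤ
  ∑f≤0 = ℤ.≤-trans (sumF-mono-≤ (λ i → ℤ.≮⇒≥ (λ 0<fᵢ → none (i , 0<fᵢ))))
                   (ℤ.≤-reflexive (sumF-zero {n}))

-- Index sets are characteristic functions rather than Subsets, so that they can be built with
-- insertAt and transported along permutations.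
sumWhere : ∀ {n} → (Fin n → ℤ) → (Fin n → Bool) → ℤ
sumWhere f c = sumF (λ i → if c i then f i else 0ℤ)

sumWhere-insertAt : ∀ {n} (f : Fin (ℕ.suc n) → ℤ) i (c : Fin n → Bool) b →
                    sumWhere f (insertAt c i b) ≡ (if b then f i else 0ℤ) + sumWhere (removeAt f i) c
sumWhere-insertAt f i c b = trans (sumF-removeAt (λ j → if insertAt c i b j then f j else 0ℤ) i)
  (cong₂ _+_ (cong (λ b′ → if b′ then f i else 0ℤ) (insertAt-lookup c i b))
             (sumF-cong (λ k → cong (λ b′ → if b′ then f (punchIn i k) else 0ℤ)
                                    (insertAt-punchIn c i b k))))

sumWhere-permute : ∀ {n} (f : Fin n → ℤ) (σ : Permutation′ n) c →
                   sumWhere (λ i → f (σ ⟨$⟩ʳ i)) c ≡ sumWhere f (λ j → c (σ ⟨$⟩ˡ j))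
sumWhere-permute f σ c = sym (trans (sumF-permute (λ j → if c (σ ⟨$⟩ˡ j) then f j else 0ℤ) σ)
  (sumF-cong (λ i → cong (λ b → if c b then f (σ ⟨$⟩ʳ i) else 0ℤ) (inverseˡ σ))))

ZeroSumFree : ∀ {n} → (Fin n → ℤ) → Set
ZeroSumFree f = ∀ c → (∃ λ i → c i ≡ true) → sumWhere f c ≢ 0ℤ

NoProperZeroSubsum : ∀ {n} → (Fin n → ℤ) → Set
NoProperZeroSubsum f = ∀ c → (∃ λ i → c i ≡ true) → (∃ λ i → c i ≡ false) → sumWhere f c ≢ 0ℤ

minimal⇒noProperZeroSubsum : ∀ {n} {s : Seq n} → IsMinimalZeroSum s → NoProperZeroSubsum s
minimal⇒noProperZeroSubsum {s = s} (_ , minimal) c (i , cᵢ) (j , ¬cⱼ) ∑≡0 =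
  minimal (tabulate c) (i , lookup⇒[]= i (tabulate c) (trans (lookup∘tabulate c i) cᵢ)) c≢⊤
    (trans (sumF-cong (λ k → cong (λ b → if b then s k else 0ℤ) (lookup∘tabulate c k))) ∑≡0)
  where
  c≢⊤ : tabulate c ≢ ⊤
  c≢⊤ c≡⊤ = contradiction (begin
    false              ≡⟨ ¬cⱼ ⟨
    c j                ≡⟨ lookup∘tabulate c j ⟨
    lookup (tabulate c) j ≡⟨ cong (λ I → lookup I j) c≡⊤ ⟩
    lookup ⊤ j         ≡⟨ lookup-replicate j true ⟩
    true               ∎) (λ ())
    where open ≡-Reasoning

noProperZeroSubsum-permute : ∀ {n} {f : Fin n → ℤ} (σ : Permutation′ n) →
                             NoProperZeroSubsum f → NoProperZeroSubsum (λ i → f (σ ⟨$⟩ʳ i))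
noProperZeroSubsum-permute {f = f} σ noZero c (i , cᵢ) (j , ¬cⱼ) ∑≡0 =
  noZero (λ k → c (σ ⟨$⟩ˡ k))
         (σ ⟨$⟩ʳ i , trans (cong c (inverseˡ σ)) cᵢ) (σ ⟨$⟩ʳ j , trans (cong c (inverseˡ σ)) ¬cⱼ)
         (trans (sym (sumWhere-permute f σ c)) ∑≡0)

sumWhere-insertAt-false : ∀ {n} (f : Fin (ℕ.suc n) → ℤ) i (c : Fin n → Bool) →
                          sumWhere f (insertAt c i false) ≡ sumWhere (removeAt f i) c
sumWhere-insertAt-false f i c = trans (sumWhere-insertAt f i c false) (ℤ.+-identityˡ _)

zeroSumFree-removeAt : ∀ {n} (f : Fin (ℕ.suc n) → ℤ) → ZeroSumFree f → ∀ i →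
                       ZeroSumFree (removeAt f i)
zeroSumFree-removeAt f zsf i c (k , cₖ) ∑≡0 =
  zsf (insertAt c i false) (punchIn i k , trans (insertAt-punchIn c i false k) cₖ)
    (trans (sumWhere-insertAt-false f i c) ∑≡0)

noProperZeroSubsum⇒zeroSumFree-removeAt : ∀ {n} (f : Fin (ℕ.suc n) → ℤ) → NoProperZeroSubsum f → ∀ i →
                                         ZeroSumFree (removeAt f i)
noProperZeroSubsum⇒zeroSumFree-removeAt f noZero i c (k , cₖ) ∑≡0 =
  noZero (insertAt c i false)
         (punchIn i k , trans (insertAt-punchIn c i false k) cₖ) (i , insertAt-lookup c i false)
         (trans (sumWhere-insertAt-false f i c) ∑≡0)

noProperZeroSubsum⇒≢0 : ∀ {n} {f : Fin n → ℤ} → NoProperZeroSubsum f → ∀ {i j} → i ≢ j → f i ≢ 0ℤ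
noProperZeroSubsum⇒≢0 {ℕ.suc n} {f} noZero {i} {j} i≢j fᵢ≡0 =
  noZero singleton (i , insertAt-lookup _ i true) (j , ¬singletonⱼ) ∑≡0
  where
  singleton : Fin (ℕ.suc n) → Bool
  singleton = insertAt (λ _ → false) i true
  ¬singletonⱼ : singleton j ≡ false
  ¬singletonⱼ = trans (cong singleton (sym (Fin.punchIn-punchOut i≢j))) (insertAt-punchIn _ i true _)
  ∑≡0 : sumWhere f singleton ≡ 0ℤ
  ∑≡0 = trans (sumWhere-insertAt f i _ true) (cong₂ _+_ fᵢ≡0 (sumF-zero {n}))

sumWhere-neg : ∀ {n} (f : Fin n → ℤ) c → sumWhere (λ i → - f i) c ≡ - sumWhere f c
sumWhere-neg f c =
  trans (sumF-cong (λ i → if-neg (c i) (f i))) (sumF-neg (λ i → if c i then f i else 0ℤ))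
  where
  if-neg : ∀ b y → (if b then - y else 0ℤ) ≡ - (if b then y else 0ℤ)
  if-neg true  y = refl
  if-neg false y = refl

noProperZeroSubsum-neg : ∀ {n} {f : Fin n → ℤ} → NoProperZeroSubsum f →
                         NoProperZeroSubsum (λ i → - f i)
noProperZeroSubsum-neg {f = f} noZero c someIn someOut ∑≡0 = noZero c someIn someOut
  (trans (sym (ℤ.neg-involutive _)) (cong -_ (trans (sym (sumWhere-neg f c)) ∑≡0)))

zeroSum-neg : ∀ {n} (s : Seq n) → IsZeroSum s → IsZeroSum (λ i → - s i)
zeroSum-neg s zeroSum = trans (sumF-neg s) (cong -_ zeroSum)

neg-∈⟦⟧ : ∀ {x a b : ℤ} → x ∈⟦ - a , b ⟧ → (- x) ∈⟦ - b , a ⟧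
neg-∈⟦⟧ {a = a} (-a≤x , x≤b) =
  ℤ.neg-mono-≤ x≤b , subst (- _ Z.≤_) (ℤ.neg-involutive a) (ℤ.neg-mono-≤ -a≤x)

<ᵇ≡true : ∀ {u v} → u < v → (u <ᵇ v) ≡ true
<ᵇ≡true u<v = Equivalence.to T-≡ (ℕ.<⇒<ᵇ u<v)

<ᵇ≡false : ∀ {u v} → v ≤ u → (u <ᵇ v) ≡ false
<ᵇ≡false {u} {v} v≤u with u <ᵇ v in u<ᵇv
... | false = refl
... | true = contradiction (ℕ.<ᵇ⇒< u v (Equivalence.from T-≡ u<ᵇv)) (ℕ.≤⇒≯ v≤u)

if-split : ∀ (b b′ : Bool) (y : ℤ) → (b′ ≡ true → b ≡ true) →
           (if b then y else 0ℤ) ≡ (if b′ then y else 0ℤ) + (if not b′ ∧ b then y else 0ℤ)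
if-split true  true  y _ = sym (ℤ.+-identityʳ y)
if-split true  false y _ = sym (ℤ.+-identityˡ y)
if-split false true  y b′⇒b with b′⇒b refl
... | ()
if-split false false y _ = refl

between : ℕ → ℕ → ℕ → Bool
between J K u = not (u <ᵇ J) ∧ (u <ᵇ K)

prefixSum-split : ∀ {n} (f : Fin n → ℤ) {J K} → J ≤ K →
                  prefixSum f K ≡ prefixSum f J + sumWhere f (λ i → between J K (toℕ i))
prefixSum-split f {J} {K} J≤K = trans (sumF-cong (λ i → if-split _ _ (f i) (<ᵇ-mono (toℕ i))))
  (sumF-+ (λ i → if toℕ i <ᵇ J then f i else 0ℤ) (λ i → if between J K (toℕ i) then f i else 0ℤ))
  where
  <ᵇ-mono : ∀ u → (u <ᵇ J) ≡ true → (u <ᵇ K) ≡ true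
  <ᵇ-mono u u<ᵇJ = <ᵇ≡true (ℕ.<-≤-trans (ℕ.<ᵇ⇒< u J (Equivalence.from T-≡ u<ᵇJ)) J≤K)

prefixSum-≢ : ∀ {n} {f : Fin n → ℤ} → NoProperZeroSubsum f → ∀ {i j} → toℕ i < toℕ j →
              prefixSum f (ℕ.suc (toℕ i)) ≢ prefixSum f (ℕ.suc (toℕ j))
prefixSum-≢ {f = f} noZero {i} {j} i<j eq =
  noZero (λ l → between J K (toℕ l)) (j , inSegment) (i , outOfSegment)
         (+ℤ.identityʳ-unique _ _ (sym (trans eq split)))
  where
  J K : ℕ
  J = ℕ.suc (toℕ i)
  K = ℕ.suc (toℕ j)
  split : prefixSum f K ≡ prefixSum f J + sumWhere f (λ l → between J K (toℕ l))
  split = prefixSum-split f (ℕ.s≤s (ℕ.<⇒≤ i<j))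
  inSegment : between J K (toℕ j) ≡ true
  inSegment rewrite <ᵇ≡false {toℕ j} {J} i<j | <ᵇ≡true {toℕ j} {K} ℕ.≤-refl = refl
  outOfSegment : between J K (toℕ i) ≡ false
  outOfSegment rewrite <ᵇ≡true {toℕ i} {J} ℕ.≤-refl = refl

prefixSums-injective : ∀ {n} {f : Fin n → ℤ} → NoProperZeroSubsum f →
                       Injective _≡_ _≡_ (λ (i : Fin n) → prefixSum f (ℕ.suc (toℕ i)))
prefixSums-injective noZero {i} {j} eq with Fin.<-cmp i j
... | tri< i<j _ _ = contradiction eq (prefixSum-≢ noZero i<j)
... | tri≈ _ i≡j _ = i≡j
... | tri> _ _ j<i = contradiction (sym eq) (prefixSum-≢ noZero j<i)

injective⇒length≤width : ∀ {n a b w} (f : Fin n → ℤ) → Injective _≡_ _≡_ f →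
                         (∀ i → f i ∈⟦ a , b ⟧) → b - a + 1ℤ ≡ + w → n ≤ w
injective⇒length≤width {n} {a} {b} {w} f f-injective f∈[a,b] width =
  Fin.injective⇒≤ offset-injective
  where
  0≤offset : ∀ i → 0ℤ Z.≤ f i - a
  0≤offset i = ℤ.i≤j⇒0≤j-i (proj₁ (f∈[a,b] i))
  offset<w : ∀ i → Z.∣ f i - a ∣ < w
  offset<w i = ℤ.drop‿+<+ (begin-strict
    + Z.∣ f i - a ∣  ≡⟨ ℤ.0≤i⇒+∣i∣≡i (0≤offset i) ⟩
    f i - a          ≤⟨ ℤ.+-monoˡ-≤ (- a) (proj₂ (f∈[a,b] i)) ⟩
    b - a            <⟨ ℤ.suc[i]≤j⇒i<j (ℤ.≤-reflexive (ℤ.+-comm 1ℤ (b - a))) ⟩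
    b - a + 1ℤ       ≡⟨ width ⟩
    + w              ∎)
    where open ℤ.≤-Reasoning
  offset : Fin n → Fin w
  offset i = fromℕ< (offset<w i)
  offset-injective : Injective _≡_ _≡_ offset
  offset-injective {i} {j} eq = f-injective (+ℤ.∙-cancelʳ (- a) (f i) (f j) (begin
    f i - a          ≡⟨ ℤ.0≤i⇒+∣i∣≡i (0≤offset i) ⟨
    + Z.∣ f i - a ∣  ≡⟨ cong +_ (Fin.toℕ-fromℕ< (offset<w i)) ⟨
    + toℕ (offset i) ≡⟨ cong (+_ ∘ toℕ) eq ⟩
    + toℕ (offset j) ≡⟨ cong +_ (Fin.toℕ-fromℕ< (offset<w j)) ⟩
    + Z.∣ f j - a ∣  ≡⟨ ℤ.0≤i⇒+∣i∣≡i (0≤offset j) ⟩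
    f j - a          ∎))
    where open ≡-Reasoning

Unreachable : ∀ {n} → ℤ → ℤ → (Fin n → ℤ) → Set
Unreachable y x f = ∀ c → x + sumWhere f c ≢ y

sumWhere-insertAt-true : ∀ {n} (f : Fin (ℕ.suc n) → ℤ) x i c →
                         x + sumWhere f (insertAt c i true) ≡ x + f i + sumWhere (removeAt f i) c
sumWhere-insertAt-true f x i c =
  trans (cong (_+_ x) (sumWhere-insertAt f i c true)) (sym (ℤ.+-assoc x (f i) _))

unreachable-removeAt : ∀ {n y} x (f : Fin (ℕ.suc n) → ℤ) → Unreachable y x f → ∀ i →
                       Unreachable y (x + f i) (removeAt f i)
unreachable-removeAt x f unreachable i c eq =
  unreachable (insertAt c i true) (trans (sumWhere-insertAt-true f x i c) eq)

zeroSumFree⇒unreachable-start : ∀ {n} (f : Fin (ℕ.suc n) → ℤ) → ZeroSumFree f → ∀ x i →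
                                Unreachable x (x + f i) (removeAt f i)
zeroSumFree⇒unreachable-start f zsf x i c eq =
  zsf (insertAt c i true) (i , insertAt-lookup c i true)
      (+ℤ.identityʳ-unique x _ (trans (sumWhere-insertAt-true f x i c) eq))

nonPositive⇒unreachable : ∀ {n y} x (f : Fin n → ℤ) → (∀ i → f i Z.≤ 0ℤ) → x + sumF f ≡ 0ℤ →
                          y Z.< 0ℤ → Unreachable y x f
nonPositive⇒unreachable {y = y} x f f≤0 balanced y<0 c eq = ℤ.<-irrefl (sym eq) (begin-strict
  y                 <⟨ y<0 ⟩
  0ℤ                ≡⟨ balanced ⟨
  x + sumF f        ≤⟨ ℤ.+-monoʳ-≤ x (sumF-mono-≤ (λ i → drop (c i) (f≤0 i))) ⟩
  x + sumWhere f c  ∎)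
  where
  open ℤ.≤-Reasoning
  drop : ∀ b {z} → z Z.≤ 0ℤ → z Z.≤ (if b then z else 0ℤ)
  drop true  z≤0 = ℤ.≤-refl
  drop false z≤0 = z≤0

balanced-removeAt : ∀ {n} x (f : Fin (ℕ.suc n) → ℤ) → x + sumF f ≡ 0ℤ → ∀ i →
                    x + f i + sumF (removeAt f i) ≡ 0ℤ
balanced-removeAt x f balanced i =
  trans (ℤ.+-assoc x (f i) _) (trans (cong (_+_ x) (sym (sumF-removeAt f i))) balanced)

x+y≡0∧0<x⇒y<0 : ∀ {x y} → x + y ≡ 0ℤ → 0ℤ Z.< x → y Z.< 0ℤ
x+y≡0∧0<x⇒y<0 {x} {y} x+y≡0 0<x =
  subst (Z._< 0ℤ) (sym (+ℤ.inverseʳ-unique x y x+y≡0)) (ℤ.neg-mono-< 0<x)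

x+y≡0∧x<0⇒0<y : ∀ {x y} → x + y ≡ 0ℤ → x Z.< 0ℤ → 0ℤ Z.< y
x+y≡0∧x<0⇒0<y {x} {y} x+y≡0 x<0 =
  subst (0ℤ Z.<_) (sym (+ℤ.inverseʳ-unique x y x+y≡0)) (ℤ.neg-mono-< x<0)

all⊎counterexample : ∀ {n p q} {P : Pred (Fin n) p} {Q : Pred (Fin n) q} →
                     Decidable P → Decidable Q → (∀ i → P i → Q i) ⊎ ∃ λ i → P i × ¬ Q i
all⊎counterexample P? Q? with Fin.any? (λ i → P? i ×-dec ¬? (Q? i))
... | yes counterexample = inj₂ counterexample
... | no none = inj₁ (λ i pᵢ → decidable-stable (Q? i) (λ ¬qᵢ → none (i , pᵢ , ¬qᵢ)))

≤∧≢⇒≤-1 : ∀ {x b} → x Z.≤ b → x ≢ b → x Z.≤ b - 1ℤ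
≤∧≢⇒≤-1 {b = b} x≤b x≢b =
  ℤ.≤-trans (ℤ.i<j⇒i≤pred[j] (ℤ.≤∧≢⇒< x≤b x≢b)) (ℤ.≤-reflexive (ℤ.+-comm -1ℤ b))

≤∧≢⇒+1≤ : ∀ {x a} → a Z.≤ x → x ≢ a → a + 1ℤ Z.≤ x
≤∧≢⇒+1≤ {a = a} a≤x x≢a =
  ℤ.≤-trans (ℤ.≤-reflexive (ℤ.+-comm a 1ℤ)) (ℤ.i<j⇒suc[i]≤j (ℤ.≤∧≢⇒< a≤x (x≢a ∘ sym)))

module Walk (m M : ℤ) where

  InWindow : ℤ → Set
  InWindow x = x ∈⟦ - (m - 1ℤ) , M - + 2 ⟧

  data Safe {r} (x : ℤ) (t : Fin r → ℤ) : Set where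
    reserve : ∀ j → t j ∈⟦ 1ℤ , M - 1ℤ ⟧ → Safe x t
    avoids  : Unreachable -1ℤ x t → Safe x t

  WindowedOrdering : ∀ {r} → ℤ → (Fin r → ℤ) → Set
  WindowedOrdering {r} x t =
    Σ[ π ∈ Permutation′ r ] (∀ k → k ≤ r → InWindow (x + prefixSum (λ l → t (π ⟨$⟩ʳ l)) k))

  NextStep : ∀ {r} → ℤ → (Fin (ℕ.suc r) → ℤ) → Set
  NextStep x t = Σ[ i ∈ Fin _ ] InWindow (x + t i) × Safe (x + t i) (removeAt t i)

  step-down : ∀ {x y} → 0ℤ Z.< x → InWindow x → - m Z.≤ y → y Z.< 0ℤ → InWindow (x + y)
  step-down {x} {y} 0<x (_ , x≤M-2) -m≤y y<0 =
    (begin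
      - (m - 1ℤ)  ≡⟨ solve (m ∷ []) ⟩
      1ℤ + - m    ≤⟨ ℤ.+-mono-≤ (ℤ.i<j⇒suc[i]≤j 0<x) -m≤y ⟩
      x + y       ∎) ,
    (begin
      x + y       ≤⟨ ℤ.+-monoʳ-≤ x (ℤ.<⇒≤ y<0) ⟩
      x + 0ℤ      ≡⟨ ℤ.+-identityʳ x ⟩
      x           ≤⟨ x≤M-2 ⟩
      M - + 2     ∎)
    where open ℤ.≤-Reasoning

  step-up : ∀ {x y} → InWindow x → 0ℤ Z.< y → x + y Z.≤ M - + 2 → InWindow (x + y)
  step-up {x} {y} (1-m≤x , _) 0<y x+y≤M-2 = (begin
    - (m - 1ℤ)  ≤⟨ 1-m≤x ⟩
    x           ≡⟨ ℤ.+-identityʳ x ⟨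
    x + 0ℤ      ≤⟨ ℤ.+-monoʳ-≤ x (ℤ.<⇒≤ 0<y) ⟩
    x + y       ∎) , x+y≤M-2
    where open ℤ.≤-Reasoning

  step-up-from-minus-one : ∀ {y} → InWindow -1ℤ → y ∈⟦ 1ℤ , M - 1ℤ ⟧ → InWindow (-1ℤ + y)
  step-up-from-minus-one {y} -1∈W (1≤y , y≤M-1) = step-up -1∈W (ℤ.suc[i]≤j⇒i<j 1≤y) (begin
    -1ℤ + y          ≤⟨ ℤ.+-monoʳ-≤ -1ℤ y≤M-1 ⟩
    -1ℤ + (M - 1ℤ)   ≡⟨ solve (M ∷ []) ⟩
    M - + 2          ∎)
    where open ℤ.≤-Reasoning

  step-up-from-below : ∀ {x y} → x Z.< -1ℤ → InWindow x → 0ℤ Z.< y → y Z.≤ M →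
                       InWindow (x + y)
  step-up-from-below {x} {y} x<-1 x∈W 0<y y≤M = step-up x∈W 0<y (begin
    x + y            ≤⟨ ℤ.+-mono-≤ (ℤ.i<j⇒i≤pred[j] x<-1) y≤M ⟩
    - + 2 + M        ≡⟨ solve (M ∷ []) ⟩
    M - + 2          ∎)
    where open ℤ.≤-Reasoning

  reserve-removeAt : ∀ {r y i j} (t : Fin (ℕ.suc r) → ℤ) → i ≢ j → t j ∈⟦ 1ℤ , M - 1ℤ ⟧ →
                     Safe y (removeAt t i)
  reserve-removeAt t i≢j tⱼ∈R =
    reserve (punchOut i≢j) (subst (_∈⟦ 1ℤ , M - 1ℤ ⟧) (sym (removeAt-punchOut t i≢j)) tⱼ∈R)

  nextStep : ∀ {r} x (t : Fin (ℕ.suc r) → ℤ) → SeqOver t (- m) M → x + sumF t ≡ 0ℤ →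
             ZeroSumFree t → InWindow x → Safe x t → NextStep x t
  nextStep (+ 0) t _ balanced zsf _ _ =
    contradiction (trans (sym (ℤ.+-identityˡ _)) balanced) (zsf (λ _ → true) (zero , refl))
  nextStep x@(+[1+ _ ]) t over balanced _ x∈W safe
    with (i , tᵢ<0) ← sumF<0⇒∃<0 t (x+y≡0∧0<x⇒y<0 balanced (Z.+<+ ℕ.z<s))
    = i , step-down (Z.+<+ ℕ.z<s) x∈W (proj₁ (over i)) tᵢ<0 , keep safe
    where
    keep : Safe x t → Safe (x + t i) (removeAt t i)
    keep (reserve j tⱼ∈R) =
      reserve-removeAt t (λ { refl → ℤ.<-asym tᵢ<0 (ℤ.suc[i]≤j⇒i<j (proj₁ tⱼ∈R)) }) tⱼ∈R
    keep (avoids unreachable) = avoids (unreachable-removeAt x t unreachable i)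
  nextStep -[1+ 0 ] t _ _ zsf -1∈W (reserve j tⱼ∈R) =
    j , step-up-from-minus-one -1∈W tⱼ∈R , avoids (zeroSumFree⇒unreachable-start t zsf -1ℤ j)
  nextStep {r} -[1+ 0 ] t _ _ _ _ (avoids unreachable) =
    contradiction (cong (_+_ -1ℤ) (sumF-zero {ℕ.suc r})) (unreachable (λ _ → false))
  nextStep x@(-[1+ ℕ.suc _ ]) t over balanced _ x∈W (avoids unreachable)
    with (i , 0<tᵢ) ← 0<sumF⇒∃>0 t (x+y≡0∧x<0⇒0<y balanced Z.-<+)
    = i , step-up-from-below (Z.-<- ℕ.z<s) x∈W 0<tᵢ (proj₂ (over i)) ,
      avoids (unreachable-removeAt x t unreachable i)
  -- The reserve is spent only as the last positive term; the walk then descends to 0 and stays ≥ 0.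
  nextStep x@(-[1+ ℕ.suc _ ]) t over balanced _ x∈W (reserve j tⱼ∈R)
    with Fin.any? (λ i → ¬? (i Fin.≟ j) ×-dec (0ℤ ℤ.<? t i))
  ... | yes (i , i≢j , 0<tᵢ) =
    i , step-up-from-below (Z.-<- ℕ.z<s) x∈W 0<tᵢ (proj₂ (over i)) , reserve-removeAt t i≢j tⱼ∈R
  ... | no noOtherPositive =
    j , step-up-from-below (Z.-<- ℕ.z<s) x∈W (ℤ.suc[i]≤j⇒i<j (proj₁ tⱼ∈R)) (proj₂ (over j)) ,
    avoids (nonPositive⇒unreachable (x + t j) (removeAt t j) restNonPositive
                                    (balanced-removeAt x t balanced j) Z.-<+)
    where
    restNonPositive : ∀ k → removeAt t j k Z.≤ 0ℤ
    restNonPositive k =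
      ℤ.≮⇒≥ (λ 0<tₖ → noOtherPositive (punchIn j k , Fin.punchInᵢ≢i j k , 0<tₖ))

  inWindow-start : ∀ {r x} (f : Fin r → ℤ) → InWindow x → InWindow (x + prefixSum f 0)
  inWindow-start {r} {x} f =
    subst InWindow (sym (trans (cong (_+_ x) (sumF-zero {r})) (ℤ.+-identityʳ x)))

  extend : ∀ {r x} {t : Fin (ℕ.suc r) → ℤ} → InWindow x → ∀ i →
           WindowedOrdering (x + t i) (removeAt t i) → WindowedOrdering x t
  extend {x = x} {t} x∈W i (π , walk) = Perm.insert zero i π , λ where
    ℕ.zero _              → inWindow-start (λ l → t (Perm.insert zero i π ⟨$⟩ʳ l)) x∈W
    (ℕ.suc k) (ℕ.s≤s k≤r) → subst InWindow (ℤ.+-assoc x (t i) _) (walk k k≤r)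

  greedyOrdering : ∀ {r} x (t : Fin r → ℤ) → SeqOver t (- m) M → x + sumF t ≡ 0ℤ →
                   ZeroSumFree t → InWindow x → Safe x t → WindowedOrdering x t
  greedyOrdering {ℕ.zero} x t _ _ _ x∈W _ = Perm.id , λ where
    ℕ.zero ℕ.z≤n → inWindow-start t x∈W
  greedyOrdering {ℕ.suc r} x t over balanced zsf x∈W safe
    with (i , x+tᵢ∈W , safe′) ← nextStep x t over balanced zsf x∈W safe
    = extend x∈W i (greedyOrdering (x + t i) (removeAt t i) (over ∘ punchIn i)
                                   (balanced-removeAt x t balanced i) (zeroSumFree-removeAt t zsf i)
                                   x+tᵢ∈W safe′)

  orderingFrom : ∀ {n} (s : Seq n) → SeqOver s (- m) M → IsZeroSum s → NoProperZeroSubsum s →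
                 ∀ e p → e ≢ p → InWindow (s e) → s p ∈⟦ 1ℤ , M - 1ℤ ⟧ →
                 Σ[ σ ∈ Permutation′ n ]
                   (∀ k → 1 ≤ k → k ≤ n → InWindow (prefixSum (λ i → s (σ ⟨$⟩ʳ i)) k))
  orderingFrom {ℕ.suc _} s over zeroSum noZero e p e≢p sₑ∈W sₚ∈R
    with (π , walk) ← greedyOrdering (s e) (removeAt s e) (over ∘ punchIn e)
                                     (trans (sym (sumF-removeAt s e)) zeroSum)
                                     (noProperZeroSubsum⇒zeroSumFree-removeAt s noZero e)
                                     sₑ∈W (reserve-removeAt s e≢p sₚ∈R)
    = Perm.insert zero e π , λ where
      (ℕ.suc k) _ (ℕ.s≤s k≤r) → walk k k≤r

module Setting (m M : ℤ) (2≤m : + 2 Z.≤ m) (2≤M : + 2 Z.≤ M) {n} (s : Seq n)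
               (over : SeqOver s (- m) M) (minimal : IsMinimalZeroSum s) where

  private
    noZero : NoProperZeroSubsum s
    noZero = minimal⇒noProperZeroSubsum minimal

  PrefixSumsIn : Permutation′ n → ℤ → ℤ → Set
  PrefixSumsIn σ a b = ∀ k → 1 ≤ k → k ≤ n → prefixSum (λ i → s (σ ⟨$⟩ʳ i)) k ∈⟦ a , b ⟧

  LowOrdering HighOrdering : Permutation′ n → Set
  LowOrdering σ = PrefixSumsIn σ (- (m - 1ℤ)) (M - + 2)
  HighOrdering σ = PrefixSumsIn σ (- (m - + 2)) (M - 1ℤ)

  length≤ : ∀ σ {a b} → PrefixSumsIn σ a b → b - a + 1ℤ ≡ m + M - + 2 → + n Z.≤ m + M - + 2
  length≤ σ within width = subst (+ n Z.≤_) ∣w∣≡w (Z.+≤+ (injective⇒length≤width _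
    (prefixSums-injective (noProperZeroSubsum-permute σ noZero))
    (λ i → within (ℕ.suc (toℕ i)) (ℕ.s≤s ℕ.z≤n) (Fin.toℕ<n i))
    (trans width (sym ∣w∣≡w))))
    where
    ∣w∣≡w : + Z.∣ m + M - + 2 ∣ ≡ m + M - + 2
    ∣w∣≡w = ℤ.0≤i⇒+∣i∣≡i (ℤ.i≤j⇒0≤j-i (ℤ.≤-trans (Z.+≤+ (ℕ.s≤s (ℕ.s≤s ℕ.z≤n)))
                                                  (ℤ.+-mono-≤ 2≤m 2≤M)))

  length-bound : ∀ σ → LowOrdering σ ⊎ HighOrdering σ → + n Z.≤ m + M - + 2
  length-bound σ (inj₁ within) = length≤ σ within (solve (m ∷ M ∷ []))
  length-bound σ (inj₂ within) = length≤ σ within (solve (m ∷ M ∷ []))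

  orderingLow : ∀ e p → e ≢ p → s e ∈⟦ - (m - 1ℤ) , M - + 2 ⟧ → s p ∈⟦ 1ℤ , M - 1ℤ ⟧ →
                Σ[ σ ∈ Permutation′ n ] LowOrdering σ
  orderingLow = Walk.orderingFrom m M s over (proj₁ minimal) noZero

  orderingHigh : ∀ e p → e ≢ p → s e ∈⟦ - (m - + 2) , M - 1ℤ ⟧ → s p ∈⟦ - (m - 1ℤ) , -1ℤ ⟧ →
                 Σ[ σ ∈ Permutation′ n ] HighOrdering σ
  orderingHigh e p e≢p sₑ∈W sₚ∈R
    with (σ , within) ← Walk.orderingFrom M m (λ i → - s i) (neg-∈⟦⟧ ∘ over)
                                          (zeroSum-neg s (proj₁ minimal)) (noProperZeroSubsum-neg noZero)
                                          e p e≢p (neg-∈⟦⟧ sₑ∈W) (neg-∈⟦⟧ sₚ∈R)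
    = σ , λ k 1≤k k≤n → subst (_∈⟦ - (m - + 2) , M - 1ℤ ⟧) (ℤ.neg-involutive _)
                          (neg-∈⟦⟧ (subst (_∈⟦ - (M - 1ℤ) , m - + 2 ⟧)
                                          (sumWhere-neg (λ i → s (σ ⟨$⟩ʳ i)) _) (within k 1≤k k≤n)))

  Inner : Fin n → Set
  Inner l = s l ≢ - m × s l ≢ M

  inner? : Decidable Inner
  inner? l = ¬? (s l ℤ.≟ - m) ×-dec ¬? (s l ℤ.≟ M)

  inner-lower : ∀ {l} → Inner l → - (m - 1ℤ) Z.≤ s l
  inner-lower {l} (sₗ≢-m , _) = begin
    - (m - 1ℤ)  ≡⟨ solve (m ∷ []) ⟩
    - m + 1ℤ    ≤⟨ ≤∧≢⇒+1≤ (proj₁ (over l)) sₗ≢-m ⟩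
    s l         ∎
    where open ℤ.≤-Reasoning

  inner-upper : ∀ {l} → Inner l → s l Z.≤ M - 1ℤ
  inner-upper {l} (_ , sₗ≢M) = ≤∧≢⇒≤-1 (proj₂ (over l)) sₗ≢M

  sign : ∀ {l l′} → l ≢ l′ → (0ℤ Z.< s l) ⊎ (s l Z.< 0ℤ)
  sign {l} l≢l′ with ℤ.<-cmp 0ℤ (s l)
  ... | tri< 0<sₗ _ _ = inj₁ 0<sₗ
  ... | tri≈ _ 0≡sₗ _ = contradiction (sym 0≡sₗ) (noProperZeroSubsum⇒≢0 noZero l≢l′)
  ... | tri> _ _ sₗ<0 = inj₂ sₗ<0

  positive⇒reserve : ∀ {l} → Inner l → 0ℤ Z.< s l → s l ∈⟦ 1ℤ , M - 1ℤ ⟧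
  positive⇒reserve inner 0<sₗ = ℤ.i<j⇒suc[i]≤j 0<sₗ , inner-upper inner

  negative⇒reserve : ∀ {l} → Inner l → s l Z.< 0ℤ → s l ∈⟦ - (m - 1ℤ) , -1ℤ ⟧
  negative⇒reserve inner sₗ<0 = inner-lower inner , ℤ.i<j⇒i≤pred[j] sₗ<0

  negative⇒startLow : ∀ {l} → Inner l → s l Z.< 0ℤ → s l ∈⟦ - (m - 1ℤ) , M - + 2 ⟧
  negative⇒startLow inner sₗ<0 =
    inner-lower inner , ℤ.≤-trans (ℤ.<⇒≤ sₗ<0) (ℤ.i≤j⇒0≤j-i 2≤M)

  ≢M-1⇒startLow : ∀ {l} → Inner l → s l ≢ M - 1ℤ → s l ∈⟦ - (m - 1ℤ) , M - + 2 ⟧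
  ≢M-1⇒startLow {l} inner sₗ≢M-1 = inner-lower inner , (begin
    s l               ≤⟨ ≤∧≢⇒≤-1 (inner-upper inner) sₗ≢M-1 ⟩
    M - 1ℤ - 1ℤ       ≡⟨ solve (M ∷ []) ⟩
    M - + 2           ∎)
    where open ℤ.≤-Reasoning

  ≢1-m⇒startHigh : ∀ {l} → Inner l → s l ≢ - (m - 1ℤ) → s l ∈⟦ - (m - + 2) , M - 1ℤ ⟧
  ≢1-m⇒startHigh {l} inner sₗ≢1-m = (begin
    - (m - + 2)       ≡⟨ solve (m ∷ []) ⟩
    - (m - 1ℤ) + 1ℤ   ≤⟨ ≤∧≢⇒+1≤ (inner-lower inner) sₗ≢1-m ⟩
    s l               ∎) , inner-upper inner
    where open ℤ.≤-Reasoning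

  positivePair : ∀ {i j} → i ≢ j → Inner i → Inner j → 0ℤ Z.< s i → 0ℤ Z.< s j →
                 ∀ {e} → Inner e → s e ≢ M - 1ℤ → Σ[ σ ∈ Permutation′ n ] LowOrdering σ
  positivePair {i} {j} i≢j innerᵢ innerⱼ 0<sᵢ 0<sⱼ {e} innerₑ sₑ≢M-1 with e Fin.≟ i
  ... | yes refl =
    orderingLow e j i≢j (≢M-1⇒startLow innerₑ sₑ≢M-1) (positive⇒reserve innerⱼ 0<sⱼ)
  ... | no e≢i =
    orderingLow e i e≢i (≢M-1⇒startLow innerₑ sₑ≢M-1) (positive⇒reserve innerᵢ 0<sᵢ)

  negativePair : ∀ {i j} → i ≢ j → Inner i → Inner j → s i Z.< 0ℤ → s j Z.< 0ℤ →
                 ∀ {e} → Inner e → s e ≢ - (m - 1ℤ) → Σ[ σ ∈ Permutation′ n ] HighOrdering σ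
  negativePair {i} {j} i≢j innerᵢ innerⱼ sᵢ<0 sⱼ<0 {e} innerₑ sₑ≢1-m with e Fin.≟ i
  ... | yes refl =
    orderingHigh e j i≢j (≢1-m⇒startHigh innerₑ sₑ≢1-m) (negative⇒reserve innerⱼ sⱼ<0)
  ... | no e≢i =
    orderingHigh e i e≢i (≢1-m⇒startHigh innerₑ sₑ≢1-m) (negative⇒reserve innerᵢ sᵢ<0)

  ordering : ∀ {i j} → i ≢ j → Inner i → Inner j →
             ∀ {i₀} → Inner i₀ → s i₀ ≢ M - 1ℤ → ∀ {j₀} → Inner j₀ → s j₀ ≢ - (m - 1ℤ) →
             Σ[ σ ∈ Permutation′ n ] (LowOrdering σ ⊎ HighOrdering σ)
  ordering {i} {j} i≢j innerᵢ innerⱼ inner₀ sᵢ₀≢M-1 inner₁ sⱼ₀≢1-m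
    with sign i≢j | sign (i≢j ∘ sym)
  ... | inj₁ 0<sᵢ | inj₁ 0<sⱼ =
    map₂ inj₁ (positivePair i≢j innerᵢ innerⱼ 0<sᵢ 0<sⱼ inner₀ sᵢ₀≢M-1)
  ... | inj₂ sᵢ<0 | inj₂ sⱼ<0 =
    map₂ inj₂ (negativePair i≢j innerᵢ innerⱼ sᵢ<0 sⱼ<0 inner₁ sⱼ₀≢1-m)
  ... | inj₁ 0<sᵢ | inj₂ sⱼ<0 =
    map₂ inj₁ (orderingLow j i (i≢j ∘ sym) (negative⇒startLow innerⱼ sⱼ<0) (positive⇒reserve innerᵢ 0<sᵢ))
  ... | inj₂ sᵢ<0 | inj₁ 0<sⱼ =
    map₂ inj₁ (orderingLow i j i≢j (negative⇒startLow innerᵢ sᵢ<0) (positive⇒reserve innerⱼ 0<sⱼ))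

lemma3p8 : (m M : ℤ) → (+ 2) Z.≤ m → (+ 2) Z.≤ M →
    (n : ℕ) (s : Seq n) → SeqOver s (- m) M → IsMinimalZeroSum s →
    (∃[ i ] ∃[ j ] (i ≢ j × s i ≢ - m × s i ≢ M × s j ≢ - m × s j ≢ M)) →
    Σ[ σ ∈ Permutation′ n ]
      ((((∀ (k : ℕ) → 1 ≤ k → k ≤ n →
            prefixSum (λ i → s (σ ⟨$⟩ʳ i)) k ∈⟦ - (m - 1ℤ) , M - (+ 2) ⟧)
         ⊎ (∀ (k : ℕ) → 1 ≤ k → k ≤ n →
            prefixSum (λ i → s (σ ⟨$⟩ʳ i)) k ∈⟦ - (m - (+ 2)) , M - 1ℤ ⟧))
        × (+ n) Z.≤ m + M - (+ 2))
       ⊎ ((∀ i → s i ≢ - m → s i ≢ M → s i ≡ M - 1ℤ)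
          ⊎ (∀ i → s i ≢ - m → s i ≢ M → s i ≡ - (m - 1ℤ))))
lemma3p8 m M 2≤m 2≤M n s over minimal (i , j , i≢j , sᵢ≢-m , sᵢ≢M , sⱼ≢-m , sⱼ≢M) =
  case all⊎counterexample inner? (λ l → s l ℤ.≟ M - 1ℤ) of λ where
    (inj₁ allTop) → Perm.id , inj₂ (inj₁ (curry ∘ allTop))
    (inj₂ (i₀ , inner₀ , sᵢ₀≢M-1)) →
      case all⊎counterexample inner? (λ l → s l ℤ.≟ - (m - 1ℤ)) of λ where
        (inj₁ allBottom) → Perm.id , inj₂ (inj₂ (curry ∘ allBottom))
        (inj₂ (j₀ , inner₁ , sⱼ₀≢1-m)) →
          let σ , within = ordering i≢j (sᵢ≢-m , sᵢ≢M) (sⱼ≢-m , sⱼ≢M) inner₀ sᵢ₀≢M-1 inner₁ sⱼ₀≢1-m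
          in σ , inj₁ (within , length-bound σ within)
  where open Setting m M 2≤m 2≤M s over minimal
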